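{- Let $E$ be a finite set. For every $\mathcal{W}\subseteq\{+,-,0\}^E$ we have $\mathcal{P}(\mathcal{W})\subseteq\mathcal{Q}(\mathcal{W})$.
   Context: A sign vector on $E$ is $X\in\{+,-,0\}^E$ with support $\underline{X}=\{e: X_e\neq0\}$; $-X$ swaps $+$ and $-$; composition $(X\circ Y)_e=X_e$ if $X_e\neq0$, else $Y_e$; $S(X,Y)=\{e: X_e,Y_e\neq0, X_e\neq Y_e\}$; sum $(X+Y)_e=0$ if $e\in S(X,Y)$ and $(X\circ Y)_e$ otherwise. For $X\neq Y$ with $\underline{X}=\underline{Y}$ and $e\in S(X,Y)$: $I_e(X,Y)=\{V : \underline{V}\subseteq\underline{X}-\{e\},\ V_f=X_f\text{ for all } f\notin S(X,Y)\}$, $I(X,Y)=\bigcup_{e\in S(X,Y)}I_e(X,Y)$. For arbitrary $X,Y$ and $e\in S(X,Y)$: $I'_e(X,Y)=\{V : \underline{V}\subseteq(\underline{X}\cup\underline{Y})-\{e\},\ V_f=(X\circ Y)_f\text{ for all } f\notin S(X,Y)\}$ and $I'(X,Y)=\bigcup_{e\in S(X,Y)}I'_e(X,Y)$ (empty if $S(X,Y)=\emptyset$). $\mathrm{sym}(\mathcal{W})=\{V: V,-V\in\mathcal{W}\}$, $\mathrm{asym}(\mathcal{W})=\mathcal{W}-\mathrm{sym}(\mathcal{W})$, $\mathcal{P}(\mathcal{W})=\{X+(-Y): X,Y\in\mathrm{asym}(\mathcal{W}),\ \underline{X}=\underline{Y},\ I(X,-Y)\cap\mathcal{W}=I(-X,Y)\cap\mathcal{W}=\emptyset\}$,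 and $\mathcal{Q}(\mathcal{W})=\{X+(-Y): X,Y\in\mathcal{W},\ I'(X,-Y)\cap\mathcal{W}=I'(-X,Y)\cap\mathcal{W}=\emptyset\}$. -}

module Defs where

open import Data.Nat using (ℕ)
open import Data.Fin using (Fin)
open import Data.Vec using (Vec; lookup; map; zipWith)
open import Data.Product using (Σ; _×_; ∃)
open import Relation.Binary.PropositionalEquality using (_≡_; _≢_)
open import Relation.Nullary using (¬_)
open import Data.Sum using (_⊎_)

data Sign : Set where
  ⊕ ⊖ 𝟘 : Sign

-- sign vectors on the ground set E = Fin n
SignVec : ℕ → Set
SignVec n = Vec Sign n

SignSet : ℕ → Set₁
SignSet n = SignVec n → Set

neg : Sign → Sign
neg ⊕ = ⊖
neg ⊖ = ⊕
neg 𝟘 = 𝟘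

negV : ∀ {n} → SignVec n → SignVec n
negV = map neg

comp : Sign → Sign → Sign
comp ⊕ _ = ⊕
comp ⊖ _ = ⊖
comp 𝟘 b = b

_∘ᵥ_ : ∀ {n} → SignVec n → SignVec n → SignVec n
_∘ᵥ_ = zipWith comp

add : Sign → Sign → Sign
add ⊕ ⊖ = 𝟘
add ⊖ ⊕ = 𝟘
add a b = comp a b

_+ᵥ_ : ∀ {n} → SignVec n → SignVec n → SignVec n
_+ᵥ_ = zipWith add

InSupp : ∀ {n} → SignVec n → Fin n → Set
InSupp X e = lookup X e ≢ 𝟘

InSep : ∀ {n} → SignVec n → SignVec n → Fin n → Set
InSep X Y e = lookup X e ≢ 𝟘 × lookup Y e ≢ 𝟘 × lookup X e ≢ lookup Y e

SameSupp : ∀ {n} → SignVec n → SignVec n → Set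
SameSupp {n} X Y = ∀ (f : Fin n) → (lookup X f ≡ 𝟘 → lookup Y f ≡ 𝟘) × (lookup Y f ≡ 𝟘 → lookup X f ≡ 𝟘)

-- V ∈ I_e(X,Y)   (used when supp X = supp Y)
InIe : ∀ {n} → SignVec n → SignVec n → Fin n → SignVec n → Set
InIe {n} X Y e V =
  (∀ (f : Fin n) → InSupp V f → InSupp X f × f ≢ e) ×
  (∀ (f : Fin n) → ¬ InSep X Y f → lookup V f ≡ lookup X f)

InI : ∀ {n} → SignVec n → SignVec n → SignVec n → Set
InI {n} X Y V = Σ (Fin n) λ e → InSep X Y e × InIe X Y e V

InI'e : ∀ {n} → SignVec n → SignVec n → Fin n → SignVec n → Set
InI'e {n} X Y e V =
  (∀ (f : Fin n) → InSupp V f → (lookup X f ≢ 𝟘 ⊎ lookup Y f ≢ 𝟘) × f ≢ e) ×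
  (∀ (f : Fin n) → ¬ InSep X Y f → lookup V f ≡ lookup (X ∘ᵥ Y) f)

InI' : ∀ {n} → SignVec n → SignVec n → SignVec n → Set
InI' {n} X Y V = Σ (Fin n) λ e → InSep X Y e × InI'e X Y e V

InSym : ∀ {n} → SignSet n → SignVec n → Set
InSym W V = W V × W (negV V)

InAsym : ∀ {n} → SignSet n → SignVec n → Set
InAsym W V = W V × ¬ InSym W V

InP : ∀ {n} → SignSet n → SignVec n → Set
InP {n} W Z = Σ (SignVec n) λ X → Σ (SignVec n) λ Y →
  InAsym W X × InAsym W Y × SameSupp X Y ×
  (∀ V → InI X (negV Y) V → ¬ W V) ×
  (∀ V → InI (negV X) Y V → ¬ W V) ×
  Z ≡ X +ᵥ negV Y

InQ : ∀ {n} → SignSet n → SignVec n → Set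
InQ {n} W Z = Σ (SignVec n) λ X → Σ (SignVec n) λ Y →
  W X × W Y ×
  (∀ V → InI' X (negV Y) V → ¬ W V) ×
  (∀ V → InI' (negV X) Y V → ¬ W V) ×
  Z ≡ X +ᵥ negV Y

-- When supp X = supp Y the two families of intervals coincide up to inclusion:
-- supp X ∪ supp Y = supp X and X ∘ Y = X, so I'(X,Y) ⊆ I(X,Y).  Negation preserves
-- supports, so this applies to both pairs (X,-Y) and (-X,Y), and the conditions
-- defining 𝒫(W) imply those defining 𝒬(W) with the same witnesses.
module Submission where

open import Data.Nat using (ℕ)
open import Data.Vec using (lookup)
open import Data.Vec.Properties using (lookup-map; lookup-zipWith)
open import Data.Product using (_×_; _,_; proj₁; proj₂)
open import Data.Sum using (inj₁; inj₂)
open import Relation.Binary.PropositionalEquality using (_≡_; _≢_; refl; sym; trans; cong)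
open import Relation.Nullary using (¬_)
open import Defs

neg-≡𝟘 : ∀ {a} → neg a ≡ 𝟘 → a ≡ 𝟘
neg-≡𝟘 {𝟘} _ = refl

lookup-negV-≡𝟘 : ∀ {n} (X : SignVec n) f → lookup (negV X) f ≡ 𝟘 → lookup X f ≡ 𝟘
lookup-negV-≡𝟘 X f x = neg-≡𝟘 (trans (sym (lookup-map f neg X)) x)

≡𝟘⇒lookup-negV-≡𝟘 : ∀ {n} (X : SignVec n) f → lookup X f ≡ 𝟘 → lookup (negV X) f ≡ 𝟘
≡𝟘⇒lookup-negV-≡𝟘 X f x = trans (lookup-map f neg X) (cong neg x)

SameSupp-sym : ∀ {n} (X Y : SignVec n) → SameSupp X Y → SameSupp Y X
SameSupp-sym X Y s f = proj₂ (s f) , proj₁ (s f)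

SameSupp-negʳ : ∀ {n} (X Y : SignVec n) → SameSupp X Y → SameSupp X (negV Y)
SameSupp-negʳ X Y s f = (λ x → ≡𝟘⇒lookup-negV-≡𝟘 Y f (proj₁ (s f) x))
                      , (λ y → proj₂ (s f) (lookup-negV-≡𝟘 Y f y))

SameSupp-negˡ : ∀ {n} (X Y : SignVec n) → SameSupp X Y → SameSupp (negV X) Y
SameSupp-negˡ X Y s =
  SameSupp-sym Y (negV X) (SameSupp-negʳ Y X (SameSupp-sym X Y s))

comp-≡ˡ : ∀ a b → (a ≡ 𝟘 → b ≡ 𝟘) → comp a b ≡ a
comp-≡ˡ ⊕ b _ = refl
comp-≡ˡ ⊖ b _ = refl
comp-≡ˡ 𝟘 b h = h refl

lookup-∘ᵥ-SameSupp : ∀ {n} (X Y : SignVec n) → SameSupp X Y → ∀ f → lookup (X ∘ᵥ Y) f ≡ lookup X f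
lookup-∘ᵥ-SameSupp X Y s f =
  trans (lookup-zipWith comp f X Y) (comp-≡ˡ (lookup X f) (lookup Y f) (proj₁ (s f)))

InI'⇒InI : ∀ {n} (X Y V : SignVec n) → SameSupp X Y → InI' X Y V → InI X Y V
InI'⇒InI X Y V s (e , e∈S , supp⊆ , agree) = e , e∈S , supp⊆′ , agree′
  where
  supp⊆′ : ∀ f → InSupp V f → InSupp X f × f ≢ e
  supp⊆′ f v with supp⊆ f v
  ... | inj₁ x≢𝟘 , f≢e = x≢𝟘 , f≢e
  ... | inj₂ y≢𝟘 , f≢e = (λ x≡𝟘 → y≢𝟘 (proj₁ (s f) x≡𝟘)) , f≢e

  agree′ : ∀ f → ¬ InSep X Y f → lookup V f ≡ lookup X f
  agree′ f f∉S = trans (agree f f∉S) (lookup-∘ᵥ-SameSupp X Y s f)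

corollary5p1 : (n : ℕ) (W : SignSet n) (Z : SignVec n) → InP W Z → InQ W Z
corollary5p1 n W Z (X , Y , X∈asym , Y∈asym , s , I[X,-Y]∉W , I[-X,Y]∉W , Z≡) =
  X , Y , proj₁ X∈asym , proj₁ Y∈asym
  , (λ V V∈I' → I[X,-Y]∉W V (InI'⇒InI X (negV Y) V (SameSupp-negʳ X Y s) V∈I'))
  , (λ V V∈I' → I[-X,Y]∉W V (InI'⇒InI (negV X) Y V (SameSupp-negˡ X Y s) V∈I'))
  , Z≡
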